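{- The set $\mathcal{S}$ is a bounded sublattice of the lattice $M_3[\mathcal{F}(\kappa)]$.
   Context: Let $\kappa$ be an infinite cardinal, identified with the set of ordinals less than $\kappa$. Let $\mathcal{F}(\kappa)=\{X\subseteq\kappa : X \text{ is finite or } \kappa\setminus X \text{ is finite}\}$. For subsets $A,B,C\subseteq\kappa$ put $\mu\langle A,B,C\rangle=(A\cap B)\cup(A\cap C)\cup(B\cap C)$ and $\overline{\langle A,B,C\rangle}=\langle A\cup\mu,\ B\cup\mu,\ C\cup\mu\rangle$ with $\mu=\mu\langle A,B,C\rangle$. A triple $\langle A,B,C\rangle$ is balanced if $A\cap B=A\cap C=B\cap C$. $M_3[\mathcal{F}(\kappa)]$ is the set of balanced triples in $\mathcal{F}(\kappa)^3$, ordered componentwise; it is a lattice with bounds $\langle\emptyset,\emptyset,\emptyset\rangle$, $\langle\kappa,\kappa,\kappa\rangle$, meet $\langle A,B,C\rangle\wedge\langle A',B',C'\rangle=\langle A\cap A',B\cap B',C\cap C'\rangle$ and join $\langle A,B,C\rangle\vee\langle A',B',C'\rangle=\overline{\langle A\cup A',B\cup B',C\cup C'\rangle}$. Let $\mathcal{T}=\{\langle A,B,C\rangle\in\mathcal{F}(\kappa)^3 : C\setminus\mu\langle A,B,C\rangle \text{ is finite}\}$ and $\mathcal{S}=\mathcal{T}\cap M_3[\mathcal{F}(\kappa)]$. -}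

module Defs where

open import Data.Bool using (Bool; true; false; _∧_; _∨_; not)
open import Data.List using (List)
open import Data.List.Membership.Propositional using (_∈_; _∉_)
open import Data.Product using (Σ; ∃; _×_; _,_)
open import Data.Sum using (_⊎_)
open import Relation.Binary.PropositionalEquality using (_≡_)

Subset : Set → Set
Subset K = K → Bool

module _ {K : Set} where

  ∅ : Subset K
  ∅ _ = false

  full : Subset K
  full _ = true

  _∩_ : Subset K → Subset K → Subset K
  (X ∩ Y) x = X x ∧ Y x

  _∪_ : Subset K → Subset K → Subset K
  (X ∪ Y) x = X x ∨ Y x

  _∖_ : Subset K → Subset K → Subset K
  (X ∖ Y) x = X x ∧ not (Y x)

  Finite : Subset K → Set
  Finite X = Σ (List K) λ xs → ∀ x → X x ≡ true → x ∈ xs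

  Cofinite : Subset K → Set
  Cofinite X = Finite (λ x → not (X x))

  InF : Subset K → Set
  InF X = Finite X ⊎ Cofinite X

  _≐_ : Subset K → Subset K → Set
  X ≐ Y = ∀ x → X x ≡ Y x

  record Triple : Set where
    constructor ⟨_,_,_⟩
    field
      A B C : Subset K
  open Triple public

  μ : Triple → Subset K
  μ t = ((A t ∩ B t) ∪ (A t ∩ C t)) ∪ (B t ∩ C t)

  closure : Triple → Triple
  closure t = ⟨ A t ∪ μ t , B t ∪ μ t , C t ∪ μ t ⟩

  Balanced : Triple → Set
  Balanced t = ((A t ∩ B t) ≐ (A t ∩ C t)) × ((A t ∩ C t) ≐ (B t ∩ C t))

  InF³ : Triple → Set
  InF³ t = InF (A t) × InF (B t) × InF (C t)

  InM3 : Triple → Set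
  InM3 t = InF³ t × Balanced t

  bot : Triple
  bot = ⟨ ∅ , ∅ , ∅ ⟩

  top : Triple
  top = ⟨ full , full , full ⟩

  _⊓_ : Triple → Triple → Triple
  s ⊓ t = ⟨ A s ∩ A t , B s ∩ B t , C s ∩ C t ⟩

  _⊔_ : Triple → Triple → Triple
  s ⊔ t = closure ⟨ A s ∪ A t , B s ∪ B t , C s ∪ C t ⟩

  InT : Triple → Set
  InT t = InF³ t × Finite (C t ∖ μ t)

  InS : Triple → Set
  InS t = InT t × InM3 t

  record IsBoundedSublatticeOfM3 (P : Triple → Set) : Set where
    field
      subset   : ∀ t → P t → InM3 t
      has-bot  : P bot
      has-top  : P top
      meet-closed : ∀ s t → P s → P t → P (s ⊓ t)
      join-closed : ∀ s t → P s → P t → P (s ⊔ t)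

Infinite : Set → Set
Infinite K = ∀ (xs : List K) → ∃ λ x → x ∉ xs

-- At each point a balanced triple shows one of the five bit patterns 0, a, b, c, 1 of M₃;
-- these patterns are closed under coordinatewise ∧, and the closure of any triple has
-- such a pattern everywhere, which gives balance of meets and joins.  For the defining
-- condition of 𝒯 note that C ∖ μ = C ∖ (A ∪ B) and that closing a triple does not change
-- C ∖ μ; hence C ∖ μ of a join, and of a meet with a balanced factor, lies inside the
-- union of the C ∖ μ of the two arguments.  Finite-or-cofinite sets are closed under
-- ∩ and ∪ by De Morgan.
module Submission where

open import Data.Bool using (Bool; true; false; _∧_; _∨_; not)
open import Data.Bool.Properties using (∧-conicalˡ; ∧-conicalʳ; ∨-∧-booleanAlgebra)
open import Algebra.Lattice.Properties.BooleanAlgebra ∨-∧-booleanAlgebra using (deMorgan₁; deMorgan₂)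
open import Data.List using ([]; _++_)
open import Data.List.Membership.Propositional.Properties using (∈-++⁺ˡ; ∈-++⁺ʳ)
open import Data.Product using (_×_; _,_; proj₁; proj₂)
open import Data.Sum using (_⊎_; inj₁; inj₂; [_,_]′)
open import Function using (_∘_)
open import Relation.Binary.PropositionalEquality using (_≡_; refl; sym; trans; cong₂)

open import Defs

∨-true : ∀ a b → a ∨ b ≡ true → a ≡ true ⊎ b ≡ true
∨-true true  _ _ = inj₁ refl
∨-true false _ p = inj₂ p

maj : Bool → Bool → Bool → Bool
maj a b c = ((a ∧ b) ∨ (a ∧ c)) ∨ (b ∧ c)

data IsM₃ : Bool → Bool → Bool → Set where
  none  : IsM₃ false false false
  onlyA : IsM₃ true  false false
  onlyB : IsM₃ false true  false
  onlyC : IsM₃ false false true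
  all   : IsM₃ true  true  true

balanced⇒IsM₃ : ∀ a b c → a ∧ b ≡ a ∧ c → a ∧ c ≡ b ∧ c → IsM₃ a b c
balanced⇒IsM₃ false false false _  _  = none
balanced⇒IsM₃ true  false false _  _  = onlyA
balanced⇒IsM₃ false true  false _  _  = onlyB
balanced⇒IsM₃ false false true  _  _  = onlyC
balanced⇒IsM₃ true  true  true  _  _  = all
balanced⇒IsM₃ true  true  false () _
balanced⇒IsM₃ true  false true  () _
balanced⇒IsM₃ false true  true  _  ()

IsM₃⇒balanced : ∀ {a b c} → IsM₃ a b c → (a ∧ b ≡ a ∧ c) × (a ∧ c ≡ b ∧ c)
IsM₃⇒balanced none  = refl , refl
IsM₃⇒balanced onlyA = refl , refl
IsM₃⇒balanced onlyB = refl , refl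
IsM₃⇒balanced onlyC = refl , refl
IsM₃⇒balanced all   = refl , refl

IsM₃-∧ : ∀ {a b c a′ b′ c′} → IsM₃ a b c → IsM₃ a′ b′ c′ → IsM₃ (a ∧ a′) (b ∧ b′) (c ∧ c′)
IsM₃-∧                 none  _ = none
IsM₃-∧ {a′ = false}    onlyA _ = none
IsM₃-∧ {a′ = true}     onlyA _ = onlyA
IsM₃-∧ {b′ = false}    onlyB _ = none
IsM₃-∧ {b′ = true}     onlyB _ = onlyB
IsM₃-∧ {c′ = false}    onlyC _ = none
IsM₃-∧ {c′ = true}     onlyC _ = onlyC
IsM₃-∧                 all   m = m

IsM₃-closure : ∀ a b c → IsM₃ (a ∨ maj a b c) (b ∨ maj a b c) (c ∨ maj a b c)
IsM₃-closure false false false = none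
IsM₃-closure true  false false = onlyA
IsM₃-closure false true  false = onlyB
IsM₃-closure false false true  = onlyC
IsM₃-closure true  true  false = all
IsM₃-closure true  false true  = all
IsM₃-closure false true  true  = all
IsM₃-closure true  true  true  = all

∖maj≡∖∨ : ∀ a b c → c ∧ not (maj a b c) ≡ c ∧ not (a ∨ b)
∖maj≡∖∨ _     _     false = refl
∖maj≡∖∨ false false true  = refl
∖maj≡∖∨ false true  true  = refl
∖maj≡∖∨ true  false true  = refl
∖maj≡∖∨ true  true  true  = refl

∖maj-closure : ∀ a b c → let m = maj a b c in (c ∨ m) ∧ not (maj (a ∨ m) (b ∨ m) (c ∨ m)) ≡ c ∧ not m
∖maj-closure false false false = refl
∖maj-closure true  false false = refl
∖maj-closure false true  false = refl
∖maj-closure false false true  = refl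
∖maj-closure true  true  false = refl
∖maj-closure true  false true  = refl
∖maj-closure false true  true  = refl
∖maj-closure true  true  true  = refl

∖maj-∧ : ∀ {a b c} a′ b′ c′ → IsM₃ a b c →
         (c ∧ c′) ∧ not (maj (a ∧ a′) (b ∧ b′) (c ∧ c′)) ≡ true →
         c ∧ not (maj a b c) ∨ c′ ∧ not (maj a′ b′ c′) ≡ true
∖maj-∧ _ _ _ none  ()
∖maj-∧ _ _ _ onlyA ()
∖maj-∧ _ _ _ onlyB ()
∖maj-∧ _ _ _ onlyC _ = refl
∖maj-∧ _ _ _ all   p = p

∖∨-subdistrib : ∀ a b c a′ b′ c′ → (c ∨ c′) ∧ not ((a ∨ a′) ∨ (b ∨ b′)) ≡ true →
                c ∧ not (a ∨ b) ∨ c′ ∧ not (a′ ∨ b′) ≡ true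
∖∨-subdistrib _     _     false _     _     false ()
∖∨-subdistrib true  _     true  _     _     _     ()
∖∨-subdistrib false _     true  true  _     _     ()
∖∨-subdistrib false true  true  false _     _     ()
∖∨-subdistrib false false true  false true  _     ()
∖∨-subdistrib false false true  false false _     _ = refl
∖∨-subdistrib true  _     false _     _     true  ()
∖∨-subdistrib false _     false true  _     true  ()
∖∨-subdistrib false true  false false _     true  ()
∖∨-subdistrib false false false false true  true  ()
∖∨-subdistrib false false false false false true  _ = refl

module _ {K : Set} where

  infix 4 _⊆_

  _⊆_ : Subset K → Subset K → Set
  X ⊆ Y = ∀ x → X x ≡ true → Y x ≡ true

  ∁ : Subset K → Subset K
  ∁ X x = not (X x)

  ≐⇒⊆ : {X Y : Subset K} → X ≐ Y → X ⊆ Y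
  ≐⇒⊆ X≐Y x = trans (sym (X≐Y x))

  ∩-⊆ˡ : {X Y : Subset K} → (X ∩ Y) ⊆ X
  ∩-⊆ˡ {X} {Y} x = ∧-conicalˡ (X x) (Y x)

  ∩-⊆ʳ : {X Y : Subset K} → (X ∩ Y) ⊆ Y
  ∩-⊆ʳ {X} {Y} x = ∧-conicalʳ (X x) (Y x)

  ∁-∩ : (X Y : Subset K) → ∁ (X ∩ Y) ≐ (∁ X ∪ ∁ Y)
  ∁-∩ X Y x = deMorgan₁ (X x) (Y x)

  ∁-∪ : (X Y : Subset K) → ∁ (X ∪ Y) ≐ (∁ X ∩ ∁ Y)
  ∁-∪ X Y x = deMorgan₂ (X x) (Y x)

  Finite-mono : {X Y : Subset K} → X ⊆ Y → Finite Y → Finite X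
  Finite-mono X⊆Y (ys , ys⊇Y) = ys , λ x → ys⊇Y x ∘ X⊆Y x

  Finite-∪ : {X Y : Subset K} → Finite X → Finite Y → Finite (X ∪ Y)
  Finite-∪ {X} {Y} (xs , xs⊇X) (ys , ys⊇Y) =
    xs ++ ys , λ x → [ ∈-++⁺ˡ ∘ xs⊇X x , ∈-++⁺ʳ xs ∘ ys⊇Y x ]′ ∘ ∨-true (X x) (Y x)

  InF-∩ : {X Y : Subset K} → InF X → InF Y → InF (X ∩ Y)
  InF-∩ (inj₁ X-fin) _            = inj₁ (Finite-mono ∩-⊆ˡ X-fin)
  InF-∩ (inj₂ _)     (inj₁ Y-fin) = inj₁ (Finite-mono ∩-⊆ʳ Y-fin)
  InF-∩ {X} {Y} (inj₂ X-cof) (inj₂ Y-cof) =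
    inj₂ (Finite-mono (≐⇒⊆ (∁-∩ X Y)) (Finite-∪ X-cof Y-cof))

  InF-∪ : {X Y : Subset K} → InF X → InF Y → InF (X ∪ Y)
  InF-∪ (inj₁ X-fin) (inj₁ Y-fin) = inj₁ (Finite-∪ X-fin Y-fin)
  InF-∪ {X} {Y} (inj₂ X-cof) _ =
    inj₂ (Finite-mono (λ x → ∩-⊆ˡ {∁ X} {∁ Y} x ∘ ≐⇒⊆ (∁-∪ X Y) x) X-cof)
  InF-∪ {X} {Y} (inj₁ _) (inj₂ Y-cof) =
    inj₂ (Finite-mono (λ x → ∩-⊆ʳ {∁ X} {∁ Y} x ∘ ≐⇒⊆ (∁-∪ X Y) x) Y-cof)

  InF-μ : ∀ {t : Triple {K}} → InF³ t → InF (μ t)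
  InF-μ (a , b , c) = InF-∪ (InF-∪ (InF-∩ a b) (InF-∩ a c)) (InF-∩ b c)

  InF³-⊓ : ∀ {s t : Triple {K}} → InF³ s → InF³ t → InF³ (s ⊓ t)
  InF³-⊓ (a , b , c) (a′ , b′ , c′) = InF-∩ a a′ , InF-∩ b b′ , InF-∩ c c′

  InF³-⊔ : ∀ {s t : Triple {K}} → InF³ s → InF³ t → InF³ (s ⊔ t)
  InF³-⊔ (a , b , c) (a′ , b′ , c′) = InF-∪ u₁ m , InF-∪ u₂ m , InF-∪ u₃ m
    where
    u₁ = InF-∪ a a′
    u₂ = InF-∪ b b′
    u₃ = InF-∪ c c′
    m  = InF-μ (u₁ , u₂ , u₃)

  Balanced⇒IsM₃ : ∀ {t : Triple {K}} → Balanced t → ∀ x → IsM₃ (A t x) (B t x) (C t x)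
  Balanced⇒IsM₃ (e₁ , e₂) x = balanced⇒IsM₃ _ _ _ (e₁ x) (e₂ x)

  IsM₃⇒Balanced : ∀ {t : Triple {K}} → (∀ x → IsM₃ (A t x) (B t x) (C t x)) → Balanced t
  IsM₃⇒Balanced m = (λ x → proj₁ (IsM₃⇒balanced (m x))) , (λ x → proj₂ (IsM₃⇒balanced (m x)))

  Balanced-⊓ : ∀ {s t : Triple {K}} → Balanced s → Balanced t → Balanced (s ⊓ t)
  Balanced-⊓ {s} {t} bs bt =
    IsM₃⇒Balanced {s ⊓ t} λ x → IsM₃-∧ (Balanced⇒IsM₃ {s} bs x) (Balanced⇒IsM₃ {t} bt x)

  Balanced-closure : (t : Triple {K}) → Balanced (closure t)
  Balanced-closure t = IsM₃⇒Balanced {closure t} λ x → IsM₃-closure (A t x) (B t x) (C t x)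

  remainder : Triple → Subset K
  remainder t = C t ∖ μ t

  remainder-⊓ : (s t : Triple {K}) → Balanced s → remainder (s ⊓ t) ⊆ (remainder s ∪ remainder t)
  remainder-⊓ s t bs x = ∖maj-∧ (A t x) (B t x) (C t x) (Balanced⇒IsM₃ {s} bs x)

  remainder-⊔ : (s t : Triple {K}) → remainder (s ⊔ t) ⊆ (remainder s ∪ remainder t)
  remainder-⊔ s t x =
      trans (cong₂ _∨_ (∖maj≡∖∨ (A s x) (B s x) (C s x)) (∖maj≡∖∨ (A t x) (B t x) (C t x)))
    ∘ ∖∨-subdistrib (A s x) (B s x) (C s x) (A t x) (B t x) (C t x)
    ∘ trans (sym (∖maj≡∖∨ (A u x) (B u x) (C u x)))
    ∘ trans (sym (∖maj-closure (A u x) (B u x) (C u x)))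
    where
    u = ⟨ A s ∪ A t , B s ∪ B t , C s ∪ C t ⟩

  InS-intro : ∀ {t : Triple {K}} → InF³ t → Finite (remainder t) → Balanced t → InS t
  InS-intro f r b = (f , r) , f , b

  InS-⊓ : (s t : Triple {K}) → InS s → InS t → InS (s ⊓ t)
  InS-⊓ s t ((_ , rs) , fs , bs) ((_ , rt) , ft , bt) =
    InS-intro (InF³-⊓ fs ft)
              (Finite-mono (remainder-⊓ s t bs) (Finite-∪ rs rt))
              (Balanced-⊓ {s} {t} bs bt)

  InS-⊔ : (s t : Triple {K}) → InS s → InS t → InS (s ⊔ t)
  InS-⊔ s t ((_ , rs) , fs , _) ((_ , rt) , ft , _) =
    InS-intro (InF³-⊔ fs ft)
              (Finite-mono (remainder-⊔ s t) (Finite-∪ rs rt))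
              (Balanced-closure ⟨ A s ∪ A t , B s ∪ B t , C s ∪ C t ⟩)

lemma3p3 : (K : Set) → Infinite K → IsBoundedSublatticeOfM3 (InS {K})
lemma3p3 K _ = record
  { subset      = λ _ → proj₂
  ; has-bot     = InS-intro (∅∈F , ∅∈F , ∅∈F) ([] , λ _ ()) (IsM₃⇒Balanced λ _ → none)
  ; has-top     = InS-intro (full∈F , full∈F , full∈F) ([] , λ _ ()) (IsM₃⇒Balanced λ _ → all)
  ; meet-closed = InS-⊓
  ; join-closed = InS-⊔
  }
  where
  ∅∈F : InF {K} ∅
  ∅∈F = inj₁ ([] , λ _ ())
  full∈F : InF {K} full
  full∈F = inj₂ ([] , λ _ ())
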